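{- Let $k$ be a positive integer. Any $k$-in-out graph with exactly $2k-1$ vertices contains at least $4k-4$ directed edges.
   Context: All graphs are simple, finite, directed graphs; edges are counted as directed edges (a pair of opposite edges $(a,b),(b,a)$ counts as two). A Hamiltonian path in a directed graph $S$ from $u$ to $w$ is a directed simple path starting at $u$, ending at $w$, and visiting every vertex of $S$ exactly once. Let $S$ be a directed graph in which $k$ distinct vertices are labelled $i_1,\dots,i_k$ (the incoming vertices) and $k$ distinct vertices are labelled $o_1,\dots,o_k$ (the outgoing vertices); a vertex may be both an incoming and an outgoing vertex. $S$ is called a $k$-in-out graph if: (1) (paired vertices condition) for all $j,m\in\{1,\dots,k\}$, there is a Hamiltonian path in $S$ from $i_j$ to $o_m$ if and only if $j=m$; and (2) (single visit condition) there is no collection of two or more pairwise vertex-disjoint directed paths in $S$, each starting at an incoming vertex and finishing at an outgoing vertex (a single vertex that is both incoming and outgoing counts as such a path), whose union covers all vertices of $S$. -}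

module Defs where

open import Data.Nat using (ℕ; _+_; _≤_)
open import Data.Empty using (⊥)
open import Data.Bool using (Bool; true; false; if_then_else_)
open import Data.Fin using (Fin)
open import Data.List using (List; []; _∷_; head; last; concat; length; map; allFin)
open import Data.Nat.ListAction using (sum)
open import Data.List.Relation.Unary.All using (All)
open import Data.List.Relation.Unary.Linked using (Linked)
open import Data.List.Relation.Unary.Unique.Propositional using (Unique)
open import Data.List.Membership.Propositional using (_∈_)
open import Data.Maybe using (Maybe; just)
open import Data.Product using (_×_; ∃)
open import Relation.Binary.PropositionalEquality using (_≡_)
open import Function.Definitions using (Injective)

record DiGraph (n : ℕ) : Set where
  field
    adj      : Fin n → Fin n → Bool
    loopless : ∀ v → adj v v ≡ false

open DiGraph public

Edge : ∀ {n} → DiGraph n → Fin n → Fin n → Set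
Edge G a b = adj G a b ≡ true

edgeCount : ∀ {n} → DiGraph n → ℕ
edgeCount {n} G =
  sum (map (λ a → sum (map (λ b → if adj G a b then 1 else 0) (allFin n))) (allFin n))

IsWalk : ∀ {n} → DiGraph n → List (Fin n) → Set
IsWalk G p = Linked (Edge G) p

IsPath : ∀ {n} → DiGraph n → Fin n → Fin n → List (Fin n) → Set
IsPath G u w p = IsWalk G p × Unique p × head p ≡ just u × last p ≡ just w

HamPath : ∀ {n} → DiGraph n → Fin n → Fin n → Set
HamPath {n} G u w = ∃ λ (p : List (Fin n)) → IsPath G u w p × (∀ v → v ∈ p)

IOPath : ∀ {n k} → DiGraph n → (Fin k → Fin n) → (Fin k → Fin n) → List (Fin n) → Set
IOPath G i o p = ∃ λ j → ∃ λ m → IsPath G (i j) (o m) p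

record IsInOut {n k : ℕ} (G : DiGraph n) (i o : Fin k → Fin n) : Set where
  field
    inj-in  : Injective _≡_ _≡_ i
    inj-out : Injective _≡_ _≡_ o
    paired-yes : ∀ j → HamPath G (i j) (o j)
    paired-no  : ∀ j m → HamPath G (i j) (o m) → j ≡ m
    -- single visit condition: no collection ps of ≥ 2 paths, each from an
    -- incoming to an outgoing vertex, pairwise vertex-disjoint (and each
    -- simple), i.e. concat ps has no repetition, covering all vertices
    single-visit : ∀ (ps : List (List (Fin n))) →
      2 ≤ length ps → All (IOPath G i o) ps → Unique (concat ps) →
      (∀ v → v ∈ concat ps) → ⊥

module Submission where

-- Call a vertex incoming (outgoing) if it is some iⱼ (oⱼ), and weight a step a → b of a
-- walk by [a is outgoing] + [b is incoming]. A Hamiltonian path from iⱼ to oⱼ never steps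
-- from an outgoing to an incoming vertex, since cutting it there would give two disjoint
-- in-out paths covering the graph; so its step weights are at most 1. They add up to
-- 2k − 2, which is the number of steps, so every step has weight exactly 1: every vertex
-- that is not incoming is entered from an outgoing vertex other than oⱼ. Using two such
-- paths, each of the k − 1 non-incoming vertices has two outgoing in-neighbours, and
-- dually each of the k − 1 non-outgoing vertices has two incoming out-neighbours. The
-- two families of edges are disjoint, which gives 4k − 4 edges.

open import Defs
open import Data.Nat using (ℕ; suc; _+_; _*_; _∸_; _≤_; z≤n; s≤s)
open import Data.Nat.Properties
open import Data.Nat.Tactic.RingSolver using (solve-∀)
open import Algebra.Properties.CommutativeSemigroup +-commutativeSemigroup using (interchange)
open import Data.Bool using (true; false; if_then_else_)
open import Data.Fin using (Fin)
import Data.Fin.Properties as Fin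
open import Data.List using (List; []; _∷_; _++_; _∷ʳ_; head; last; concat; length; map; allFin)
open import Data.List.Properties using (length-map; length-tabulate; ++-assoc; ++-identityʳ)
open import Data.Nat.ListAction using (sum)
open import Data.List.Relation.Unary.All using ([]; _∷_)
import Data.List.Relation.Unary.All.Properties as All
open import Data.List.Relation.Unary.Any using (here; there)
open import Data.List.Relation.Unary.AllPairs using ([]; _∷_)
open import Data.List.Relation.Unary.Linked as Linked using (Linked; []; [-]; _∷_)
open import Data.List.Relation.Unary.Unique.Propositional using (Unique)
open import Data.List.Relation.Unary.Unique.Propositional.Properties
  using (map⁺; allFin⁺; Unique[x∷xs]⇒x∉xs)
open import Data.List.Membership.Propositional using (_∈_; _∉_)
open import Data.List.Membership.Propositional.Properties using (∈-map⁺; ∈-map⁻; ∈-allFin)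
import Data.List.Membership.DecPropositional as DecMembership
open import Data.Maybe using (just)
open import Data.Maybe.Properties using (just-injective)
open import Data.Product using (∃; ∃₂; _×_; _,_)
open import Data.Empty using (⊥; ⊥-elim)
open import Function using (_∘_)
open import Function.Definitions using (Injective)
open import Relation.Nullary using (yes; no; contradiction)
open import Relation.Binary.Definitions using (DecidableEquality)
open import Relation.Binary.PropositionalEquality

private
  variable
    A B : Set

∑ : List A → (A → ℕ) → ℕ
∑ xs f = sum (map f xs)

syntax ∑ xs (λ x → e) = ∑[ x ← xs ] e

∑-cong : ∀ {f g : A → ℕ} xs → (∀ x → f x ≡ g x) → ∑ xs f ≡ ∑ xs g
∑-cong []       f≡g = refl
∑-cong (x ∷ xs) f≡g = cong₂ _+_ (f≡g x) (∑-cong xs f≡g)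

∑-mono-≤ : ∀ {f g : A → ℕ} xs → (∀ x → f x ≤ g x) → ∑ xs f ≤ ∑ xs g
∑-mono-≤ []       f≤g = z≤n
∑-mono-≤ (x ∷ xs) f≤g = +-mono-≤ (f≤g x) (∑-mono-≤ xs f≤g)

∑-distrib-+ : ∀ (f g : A → ℕ) xs → ∑[ x ← xs ] (f x + g x) ≡ ∑ xs f + ∑ xs g
∑-distrib-+ f g []       = refl
∑-distrib-+ f g (x ∷ xs) =
  trans (cong (f x + g x +_) (∑-distrib-+ f g xs)) (interchange (f x) (g x) (∑ xs f) (∑ xs g))

∑-zero : (xs : List A) → ∑[ x ← xs ] 0 ≡ 0
∑-zero []       = refl
∑-zero (x ∷ xs) = ∑-zero xs

∑-one : (xs : List A) → ∑[ x ← xs ] 1 ≡ length xs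
∑-one []       = refl
∑-one (x ∷ xs) = cong suc (∑-one xs)

∑-swap : ∀ (f : A → B → ℕ) xs ys → ∑[ x ← xs ] ∑ ys (f x) ≡ ∑[ y ← ys ] ∑[ x ← xs ] f x y
∑-swap f []       ys = sym (∑-zero ys)
∑-swap f (x ∷ xs) ys = trans (cong (∑ ys (f x) +_) (∑-swap f xs ys))
                             (sym (∑-distrib-+ (f x) (λ y → ∑[ x′ ← xs ] f x′ y) ys))

∑-complement : ∀ {g : A → ℕ} xs → (∀ x → g x ≤ 1) → ∑[ x ← xs ] (1 ∸ g x) + ∑ xs g ≡ length xs
∑-complement {g = g} xs g≤1 = begin
  ∑[ x ← xs ] (1 ∸ g x) + ∑ xs g  ≡⟨ sym (∑-distrib-+ (λ x → 1 ∸ g x) g xs) ⟩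
  ∑[ x ← xs ] (1 ∸ g x + g x)     ≡⟨ ∑-cong xs (λ x → m∸n+n≡m (g≤1 x)) ⟩
  ∑[ x ← xs ] 1                   ≡⟨ ∑-one xs ⟩
  length xs                       ∎
  where open ≡-Reasoning

∈⇒≤∑ : ∀ (f : A → ℕ) {xs x} → x ∈ xs → f x ≤ ∑ xs f
∈⇒≤∑ f {y ∷ _} (here refl) = m≤m+n (f y) _
∈⇒≤∑ f {y ∷ _} (there x∈)  = ≤-trans (∈⇒≤∑ f x∈) (m≤n+m _ (f y))

∈₂⇒≤∑ : ∀ (f : A → ℕ) {xs x y} → x ∈ xs → y ∈ xs → x ≢ y → f x + f y ≤ ∑ xs f
∈₂⇒≤∑ f (here refl) (here refl) x≢y = contradiction refl x≢y
∈₂⇒≤∑ f (here refl) (there y∈)  _   = +-monoʳ-≤ _ (∈⇒≤∑ f y∈)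
∈₂⇒≤∑ f {y ∷ xs} {x} (there x∈) (here refl) _ =
  subst (_≤ f y + ∑ xs f) (+-comm (f y) (f x)) (+-monoʳ-≤ (f y) (∈⇒≤∑ f x∈))
∈₂⇒≤∑ f {z ∷ _} (there x∈) (there y∈) x≢y = ≤-trans (∈₂⇒≤∑ f x∈ y∈ x≢y) (m≤n+m _ (f z))

module Occurrences (_≟_ : DecidableEquality A) where
  open DecMembership _≟_ using (_∈?_)

  δ : A → A → ℕ
  δ x y with x ≟ y
  ... | yes _ = 1
  ... | no  _ = 0

  δ-refl : ∀ x → δ x x ≡ 1
  δ-refl x with x ≟ x
  ... | yes _   = refl
  ... | no  x≢x = contradiction refl x≢x

  δ-≢ : ∀ {x y} → x ≢ y → δ x y ≡ 0
  δ-≢ {x} {y} x≢y with x ≟ y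
  ... | yes x≡y = contradiction x≡y x≢y
  ... | no  _   = refl

  δ-sym : ∀ x y → δ x y ≡ δ y x
  δ-sym x y with x ≟ y | y ≟ x
  ... | yes _   | yes _   = refl
  ... | yes x≡y | no  y≢x = contradiction (sym x≡y) y≢x
  ... | no  x≢y | yes y≡x = contradiction (sym y≡x) x≢y
  ... | no  _   | no  _   = refl

  occ : A → List A → ℕ
  occ x ys = ∑ ys (δ x)

  occ-∉ : ∀ {x ys} → x ∉ ys → occ x ys ≡ 0
  occ-∉ {ys = []}     _  = refl
  occ-∉ {ys = y ∷ ys} x∉ = cong₂ _+_ (δ-≢ (x∉ ∘ here)) (occ-∉ (x∉ ∘ there))

  occ-∈ : ∀ {x ys} → Unique ys → x ∈ ys → occ x ys ≡ 1
  occ-∈ {x} ys!@(_ ∷ _) (here refl) = cong₂ _+_ (δ-refl x) (occ-∉ (Unique[x∷xs]⇒x∉xs ys!))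
  occ-∈ ys!@(_ ∷ rest!) (there x∈) =
    cong₂ _+_ (δ-≢ λ { refl → Unique[x∷xs]⇒x∉xs ys! x∈ }) (occ-∈ rest! x∈)

  occ≤1 : ∀ {x ys} → Unique ys → occ x ys ≤ 1
  occ≤1 {x} {ys} ys! with x ∈? ys
  ... | yes x∈ = ≤-reflexive (occ-∈ ys! x∈)
  ... | no  x∉ = subst (_≤ 1) (sym (occ-∉ x∉)) z≤n

  occ>0⇒∈ : ∀ {x ys} → 1 ≤ occ x ys → x ∈ ys
  occ>0⇒∈ {x} {ys} 1≤occ with x ∈? ys
  ... | yes x∈ = x∈
  ... | no  x∉ = contradiction (subst (1 ≤_) (occ-∉ x∉) 1≤occ) λ ()

  -- Double counting: both sides count the pairs (x, y) with x ∈ xs, y ∈ ys and x = y.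
  ∑-occ : ∀ {xs} ys → Unique xs → (∀ y → y ∈ xs) → ∑[ x ← xs ] occ x ys ≡ length ys
  ∑-occ {xs} ys xs! xs-covers = begin
    ∑[ x ← xs ] ∑ ys (δ x)        ≡⟨ ∑-swap δ xs ys ⟩
    ∑[ y ← ys ] ∑[ x ← xs ] δ x y ≡⟨ ∑-cong ys (λ y → ∑-cong xs (λ x → δ-sym x y)) ⟩
    ∑[ y ← ys ] occ y xs          ≡⟨ ∑-cong ys (λ y → occ-∈ xs! (xs-covers y)) ⟩
    ∑[ y ← ys ] 1                 ≡⟨ ∑-one ys ⟩
    length ys                     ∎
    where open ≡-Reasoning

length-allFin : ∀ n → length (allFin n) ≡ n
length-allFin n = length-tabulate (λ v → v)

module _ {n : ℕ} where
  open Occurrences (Fin._≟_ {n})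

  Unique∧covering⇒length≡ : ∀ {p : List (Fin n)} → Unique p → (∀ v → v ∈ p) → length p ≡ n
  Unique∧covering⇒length≡ {p} p! p-covers = begin
    length p                       ≡⟨ sym (∑-one p) ⟩
    ∑[ v ← p ] 1                   ≡⟨ ∑-cong p (λ v → sym (occ-∈ (allFin⁺ n) (∈-allFin v))) ⟩
    ∑[ v ← p ] occ v (allFin n)    ≡⟨ ∑-occ (allFin n) p! p-covers ⟩
    length (allFin n)              ≡⟨ length-allFin n ⟩
    n                              ∎
    where open ≡-Reasoning

  χ : ∀ {k} → (Fin k → Fin n) → Fin n → ℕ
  χ {k} f v = occ v (map f (allFin k))

  module _ {k} {f : Fin k → Fin n} where

    χ>0⇒label : ∀ {v} → 1 ≤ χ f v → ∃ λ j → v ≡ f j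
    χ>0⇒label 1≤χ with ∈-map⁻ f (occ>0⇒∈ {ys = map f (allFin k)} 1≤χ)
    ... | j , _ , v≡fj = j , v≡fj

    ∑-χ : ∀ {p} → Unique p → (∀ v → v ∈ p) → ∑ p (χ f) ≡ k
    ∑-χ p! p-covers =
      trans (∑-occ (map f (allFin k)) p! p-covers) (trans (length-map f (allFin k)) (length-allFin k))

    module _ (f-inj : Injective _≡_ _≡_ f) where

      χ≤1 : ∀ v → χ f v ≤ 1
      χ≤1 v = occ≤1 (map⁺ f-inj (allFin⁺ k))

      χ-label : ∀ j → χ f (f j) ≡ 1
      χ-label j = occ-∈ (map⁺ f-inj (allFin⁺ k)) (∈-map⁺ f (∈-allFin j))

      ∑-χ-complement : ∑[ v ← allFin n ] (1 ∸ χ f v) + k ≡ n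
      ∑-χ-complement = begin
        ∑[ v ← allFin n ] (1 ∸ χ f v) + k
          ≡⟨ cong (∑[ v ← allFin n ] (1 ∸ χ f v) +_) (sym (∑-χ (allFin⁺ n) ∈-allFin)) ⟩
        ∑[ v ← allFin n ] (1 ∸ χ f v) + ∑ (allFin n) (χ f)
          ≡⟨ ∑-complement (allFin n) χ≤1 ⟩
        length (allFin n)
          ≡⟨ length-allFin n ⟩
        n ∎
        where open ≡-Reasoning

Linked-++⁻ˡ : ∀ {R : A → A → Set} xs {ys} → Linked R (xs ++ ys) → Linked R xs
Linked-++⁻ˡ []           _           = []
Linked-++⁻ˡ (x ∷ [])     _           = [-]
Linked-++⁻ˡ (x ∷ y ∷ xs) (xRy ∷ xys) = xRy ∷ Linked-++⁻ˡ (y ∷ xs) xys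

Linked-++⁻ʳ : ∀ {R : A → A → Set} xs {ys} → Linked R (xs ++ ys) → Linked R ys
Linked-++⁻ʳ []       xys = xys
Linked-++⁻ʳ (x ∷ xs) xys = Linked-++⁻ʳ xs (Linked.tail xys)

Linked-infixes : ∀ {R : A → A → Set} xs →
  (∀ pre x y ys → xs ≡ pre ++ x ∷ y ∷ ys → R x y) → Linked R xs
Linked-infixes []          _       = []
Linked-infixes (x ∷ [])    _       = [-]
Linked-infixes (x ∷ y ∷ r) R-infix =
  R-infix [] x y r refl ∷
  Linked-infixes (y ∷ r) λ pre a b ys eq → R-infix (x ∷ pre) a b ys (cong (x ∷_) eq)

Unique-++⁻ˡ : ∀ (xs : List A) {ys} → Unique (xs ++ ys) → Unique xs
Unique-++⁻ˡ []       _          = []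
Unique-++⁻ˡ (x ∷ xs) (x∉ ∷ xys) = All.++⁻ˡ xs x∉ ∷ Unique-++⁻ˡ xs xys

Unique-++⁻ʳ : ∀ (xs : List A) {ys} → Unique (xs ++ ys) → Unique ys
Unique-++⁻ʳ []       xys       = xys
Unique-++⁻ʳ (x ∷ xs) (_ ∷ xys) = Unique-++⁻ʳ xs xys

head-++-∷ : ∀ xs (y : A) ys zs → head (xs ++ y ∷ ys) ≡ head (xs ++ y ∷ zs)
head-++-∷ []       y ys zs = refl
head-++-∷ (x ∷ xs) y ys zs = refl

last-++-∷ : ∀ xs (y : A) ys → last (xs ++ y ∷ ys) ≡ last (y ∷ ys)
last-++-∷ []           y ys = refl
last-++-∷ (x ∷ [])     y ys = refl
last-++-∷ (x ∷ x′ ∷ xs) y ys = last-++-∷ (x′ ∷ xs) y ys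

last⇒∈ : ∀ xs {x : A} → last xs ≡ just x → x ∈ xs
last⇒∈ (x ∷ [])     refl = here refl
last⇒∈ (x ∷ y ∷ xs) eq   = there (last⇒∈ (y ∷ xs) eq)

predecessor : ∀ {R : A → A → Set} {p v w} → Linked R p → Unique p → v ∈ p →
  head p ≢ just v → last p ≡ just w → ∃ λ a → R a v × a ≢ w
predecessor {p = x ∷ []}    _ _ (here refl) v≢head _ = contradiction refl v≢head
predecessor {p = x ∷ y ∷ r} _ _ (here refl) v≢head _ = contradiction refl v≢head
predecessor {p = x ∷ y ∷ r} (xRy ∷ _) p! (there (here refl)) _ p-last =
  x , xRy , λ { refl → Unique[x∷xs]⇒x∉xs p! (last⇒∈ (y ∷ r) p-last) }
predecessor {p = x ∷ y ∷ r} {v} (_ ∷ L) (_ ∷ r!) (there (there v∈r)) _ p-last =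
  predecessor L r! (there v∈r) y≢v p-last
  where
  y≢v : head (y ∷ r) ≢ just v
  y≢v y≡v = Unique[x∷xs]⇒x∉xs r! (subst (_∈ r) (sym (just-injective y≡v)) v∈r)

successor : ∀ {R : A → A → Set} {x r v} → Linked R (x ∷ r) → v ∈ x ∷ r →
  last (x ∷ r) ≢ just v → ∃ λ b → R v b × b ∈ r
successor {r = []}    _         (here refl) v≢last = contradiction refl v≢last
successor {r = y ∷ r} (xRy ∷ _) (here refl) _      = y , xRy , here refl
successor {r = y ∷ r} (_ ∷ L)   (there v∈)  v≢last with successor L v∈ v≢last
... | b , vRb , b∈r = b , vRb , there b∈r

pairSum : (A → A → ℕ) → List A → ℕ
pairSum w []          = 0
pairSum w (x ∷ [])    = 0
pairSum w (x ∷ y ∷ r) = w x y + pairSum w (y ∷ r)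

pairSum-telescope : ∀ (g h : A → ℕ) {x w} r → last (x ∷ r) ≡ just w →
  g w + h x + pairSum (λ a b → g a + h b) (x ∷ r) ≡ ∑ (x ∷ r) g + ∑ (x ∷ r) h
pairSum-telescope g h {x} []      refl =
  trans (+-identityʳ _) (cong₂ _+_ (sym (+-identityʳ (g x))) (sym (+-identityʳ (h x))))
pairSum-telescope g h {x} {w} (y ∷ r) x∷y∷r-last = begin
  g w + h x + (g x + h y + S)   ≡⟨ rearrange (g w) (h x) (g x) (h y) S ⟩
  g x + h x + (g w + h y + S)   ≡⟨ cong (g x + h x +_) (pairSum-telescope g h r x∷y∷r-last) ⟩
  g x + h x + (∑ (y ∷ r) g + ∑ (y ∷ r) h) ≡⟨ interchange (g x) (h x) _ _ ⟩
  ∑ (x ∷ y ∷ r) g + ∑ (x ∷ y ∷ r) h ∎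
  where
  open ≡-Reasoning
  S : ℕ
  S = pairSum (λ a b → g a + h b) (y ∷ r)
  rearrange : ∀ a b c d e → a + b + (c + d + e) ≡ c + b + (a + d + e)
  rearrange = solve-∀

pairSum-≤ : ∀ {w : A → A → ℕ} {x} r → Linked (λ a b → w a b ≤ 1) (x ∷ r) →
  pairSum w (x ∷ r) ≤ length r
pairSum-≤ []      _             = z≤n
pairSum-≤ (y ∷ r) (wxy≤1 ∷ w≤1) = +-mono-≤ wxy≤1 (pairSum-≤ r w≤1)

pairSum-saturated : ∀ {w : A → A → ℕ} {x} r → Linked (λ a b → w a b ≤ 1) (x ∷ r) →
  length r ≤ pairSum w (x ∷ r) → Linked (λ a b → 1 ≤ w a b) (x ∷ r)
pairSum-saturated []      _ _ = [-]
pairSum-saturated {w = w} {x} (y ∷ r) (wxy≤1 ∷ w≤1) full with 1 ≤? w x y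
... | yes 1≤wxy = 1≤wxy ∷ pairSum-saturated r w≤1 (≤-pred (≤-trans full (+-monoˡ-≤ _ wxy≤1)))
... | no  1≰wxy = ⊥-elim (<-irrefl refl (≤-trans full′ (pairSum-≤ r w≤1)))
  where
  full′ : suc (length r) ≤ pairSum w (y ∷ r)
  full′ = subst (λ z → suc (length r) ≤ z + pairSum w (y ∷ r)) (n<1⇒n≡0 (≰⇒> 1≰wxy)) full

IsPath-split : ∀ {n} {G : DiGraph n} {u w} pre a b ys → IsPath G u w (pre ++ a ∷ b ∷ ys) →
  IsPath G u a (pre ∷ʳ a) × IsPath G b w (b ∷ ys)
IsPath-split {G = G} pre a b ys (walk , p! , p-head , p-last) =
  ( Linked-++⁻ˡ (pre ∷ʳ a) walk′ , Unique-++⁻ˡ (pre ∷ʳ a) p!′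
  , trans (head-++-∷ pre a [] (b ∷ ys)) p-head , last-++-∷ pre a [] )
  , ( Linked-++⁻ʳ (pre ∷ʳ a) walk′ , Unique-++⁻ʳ (pre ∷ʳ a) p!′
  , refl , trans (sym (last-++-∷ pre a (b ∷ ys))) p-last )
  where
  cut : pre ++ a ∷ b ∷ ys ≡ (pre ∷ʳ a) ++ b ∷ ys
  cut = sym (++-assoc pre (a ∷ []) (b ∷ ys))
  walk′ : IsWalk G ((pre ∷ʳ a) ++ b ∷ ys)
  walk′ = subst (IsWalk G) cut walk
  p!′ : Unique ((pre ∷ʳ a) ++ b ∷ ys)
  p!′ = subst Unique cut p!

AtLeastTwo : (A → Set) → Set
AtLeastTwo P = ∃₂ λ a a′ → a ≢ a′ × P a × P a′

indicator-split : ∀ {e s t} → e ≤ 1 → s ≤ 1 → t ≤ 1 → e * (s * (1 ∸ t)) + e * ((1 ∸ s) * t) ≤ e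
indicator-split z≤n       _         _         = z≤n
indicator-split (s≤s z≤n) z≤n       z≤n       = z≤n
indicator-split (s≤s z≤n) z≤n       (s≤s z≤n) = s≤s z≤n
indicator-split (s≤s z≤n) (s≤s z≤n) z≤n       = s≤s z≤n
indicator-split (s≤s z≤n) (s≤s z≤n) (s≤s z≤n) = z≤n

-- Counts the edges from {s = 1} to {t = 0} and those from {s = 0} to {t = 1}, two disjoint sets.
module EdgeLowerBound {n} (G : DiGraph n) (s t : Fin n → ℕ)
    (s≤1 : ∀ v → s v ≤ 1) (t≤1 : ∀ v → t v ≤ 1)
    (into-t⁰ : ∀ b → t b ≡ 0 → AtLeastTwo (λ a → Edge G a b × 1 ≤ s a))
    (out-of-s⁰ : ∀ a → s a ≡ 0 → AtLeastTwo (λ b → Edge G a b × 1 ≤ t b)) where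

  private
    V : List (Fin n)
    V = allFin n

    e : Fin n → Fin n → ℕ
    e a b = if adj G a b then 1 else 0

    e≤1 : ∀ a b → e a b ≤ 1
    e≤1 a b with adj G a b
    ... | true  = s≤s z≤n
    ... | false = z≤n

    e-edge : ∀ {a b} → Edge G a b → e a b ≡ 1
    e-edge a→b = cong (λ β → if β then 1 else 0) a→b

    s⇒¬t ¬s⇒t : Fin n → Fin n → ℕ
    s⇒¬t a b = e a b * (s a * (1 ∸ t b))
    ¬s⇒t a b = e a b * ((1 ∸ s a) * t b)

    s⇒¬t-edge : ∀ {a b} → Edge G a b → t b ≡ 0 → s⇒¬t a b ≡ s a
    s⇒¬t-edge {a} {b} a→b tb≡0 = begin
      s⇒¬t a b        ≡⟨ cong₂ (λ x y → x * (s a * (1 ∸ y))) (e-edge a→b) tb≡0 ⟩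
      1 * (s a * 1)   ≡⟨ *-identityˡ _ ⟩
      s a * 1         ≡⟨ *-identityʳ (s a) ⟩
      s a             ∎
      where open ≡-Reasoning

    ¬s⇒t-edge : ∀ {a b} → Edge G a b → s a ≡ 0 → ¬s⇒t a b ≡ t b
    ¬s⇒t-edge {a} {b} a→b sa≡0 = begin
      ¬s⇒t a b        ≡⟨ cong₂ (λ x y → x * ((1 ∸ y) * t b)) (e-edge a→b) sa≡0 ⟩
      1 * (1 * t b)   ≡⟨ *-identityˡ _ ⟩
      1 * t b         ≡⟨ *-identityˡ (t b) ⟩
      t b             ∎
      where open ≡-Reasoning

    column : ∀ b → (1 ∸ t b) + (1 ∸ t b) ≤ ∑[ a ← V ] s⇒¬t a b
    column b with t b ≟ 0
    ... | no tb≢0 = subst (_≤ ∑[ a ← V ] s⇒¬t a b) (sym (cong₂ _+_ 1∸tb≡0 1∸tb≡0)) z≤n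
      where
      1∸tb≡0 : 1 ∸ t b ≡ 0
      1∸tb≡0 = m≤n⇒m∸n≡0 (n≢0⇒n>0 tb≢0)
    ... | yes tb≡0 with into-t⁰ b tb≡0
    ...   | a , a′ , a≢a′ , (a→b , 1≤sa) , (a′→b , 1≤sa′) = begin
      (1 ∸ t b) + (1 ∸ t b)     ≡⟨ cong (λ z → (1 ∸ z) + (1 ∸ z)) tb≡0 ⟩
      1 + 1                     ≤⟨ +-mono-≤ 1≤sa 1≤sa′ ⟩
      s a + s a′                ≡⟨ sym (cong₂ _+_ (s⇒¬t-edge a→b tb≡0) (s⇒¬t-edge a′→b tb≡0)) ⟩
      s⇒¬t a b + s⇒¬t a′ b      ≤⟨ ∈₂⇒≤∑ (λ x → s⇒¬t x b) (∈-allFin a) (∈-allFin a′) a≢a′ ⟩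
      ∑[ x ← V ] s⇒¬t x b       ∎
      where open ≤-Reasoning

    row : ∀ a → (1 ∸ s a) + (1 ∸ s a) ≤ ∑ V (¬s⇒t a)
    row a with s a ≟ 0
    ... | no sa≢0 = subst (_≤ ∑ V (¬s⇒t a)) (sym (cong₂ _+_ 1∸sa≡0 1∸sa≡0)) z≤n
      where
      1∸sa≡0 : 1 ∸ s a ≡ 0
      1∸sa≡0 = m≤n⇒m∸n≡0 (n≢0⇒n>0 sa≢0)
    ... | yes sa≡0 with out-of-s⁰ a sa≡0
    ...   | b , b′ , b≢b′ , (a→b , 1≤tb) , (a→b′ , 1≤tb′) = begin
      (1 ∸ s a) + (1 ∸ s a)     ≡⟨ cong (λ z → (1 ∸ z) + (1 ∸ z)) sa≡0 ⟩
      1 + 1                     ≤⟨ +-mono-≤ 1≤tb 1≤tb′ ⟩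
      t b + t b′                ≡⟨ sym (cong₂ _+_ (¬s⇒t-edge a→b sa≡0) (¬s⇒t-edge a→b′ sa≡0)) ⟩
      ¬s⇒t a b + ¬s⇒t a b′      ≤⟨ ∈₂⇒≤∑ (¬s⇒t a) (∈-allFin b) (∈-allFin b′) b≢b′ ⟩
      ∑ V (¬s⇒t a)              ∎
      where open ≤-Reasoning

  edgeCount-≥ : let ∁t = ∑[ v ← allFin n ] (1 ∸ t v)
                    ∁s = ∑[ v ← allFin n ] (1 ∸ s v)
                in (∁t + ∁t) + (∁s + ∁s) ≤ edgeCount G
  edgeCount-≥ = begin
    (∑[ v ← V ] (1 ∸ t v) + ∑[ v ← V ] (1 ∸ t v)) + (∑[ v ← V ] (1 ∸ s v) + ∑[ v ← V ] (1 ∸ s v))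
      ≡⟨ sym (cong₂ _+_ (∑-distrib-+ _ _ V) (∑-distrib-+ _ _ V)) ⟩
    ∑[ b ← V ] ((1 ∸ t b) + (1 ∸ t b)) + ∑[ a ← V ] ((1 ∸ s a) + (1 ∸ s a))
      ≤⟨ +-mono-≤ (∑-mono-≤ V column) (∑-mono-≤ V row) ⟩
    ∑[ b ← V ] ∑[ a ← V ] s⇒¬t a b + ∑[ a ← V ] ∑ V (¬s⇒t a)
      ≡⟨ cong (_+ ∑[ a ← V ] ∑ V (¬s⇒t a)) (sym (∑-swap s⇒¬t V V)) ⟩
    ∑[ a ← V ] ∑ V (s⇒¬t a) + ∑[ a ← V ] ∑ V (¬s⇒t a)
      ≡⟨ sym (∑-distrib-+ _ _ V) ⟩
    ∑[ a ← V ] (∑ V (s⇒¬t a) + ∑ V (¬s⇒t a))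
      ≡⟨ ∑-cong V (λ a → sym (∑-distrib-+ (s⇒¬t a) (¬s⇒t a) V)) ⟩
    ∑[ a ← V ] ∑[ b ← V ] (s⇒¬t a b + ¬s⇒t a b)
      ≤⟨ ∑-mono-≤ V (λ a → ∑-mono-≤ V (λ b → indicator-split (e≤1 a b) (s≤1 a) (t≤1 b))) ⟩
    edgeCount G ∎
    where open ≤-Reasoning

module InOutGraph {n k} (G : DiGraph n) (i o : Fin (suc k) → Fin n) (io : IsInOut G i o)
    (size : n ≡ k + suc k) where

  open IsInOut io

  χᵢ χₒ : Fin n → ℕ
  χᵢ = χ i
  χₒ = χ o

  weight : Fin n → Fin n → ℕ
  weight a b = χₒ a + χᵢ b

  no-out→in : ∀ {j j′} pre m m′ ys → IsPath G (i j) (o j′) (pre ++ o m ∷ i m′ ∷ ys) →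
    (∀ v → v ∈ pre ++ o m ∷ i m′ ∷ ys) → ⊥
  no-out→in pre m m′ ys path@(_ , p! , _) covers with IsPath-split {G = G} pre (o m) (i m′) ys path
  ... | path₁ , path₂ = single-visit (pre ∷ʳ o m ∷ (i m′ ∷ ys) ∷ []) (s≤s (s≤s z≤n))
    ((_ , _ , path₁) ∷ (_ , _ , path₂) ∷ [])
    (subst Unique (sym glue) p!)
    (λ v → subst (v ∈_) (sym glue) (covers v))
    where
    glue : concat (pre ∷ʳ o m ∷ (i m′ ∷ ys) ∷ []) ≡ pre ++ o m ∷ i m′ ∷ ys
    glue = trans (cong ((pre ∷ʳ o m) ++_) (++-identityʳ (i m′ ∷ ys))) (++-assoc pre _ _)

  weight≤1 : ∀ {j j′ p} → IsPath G (i j) (o j′) p → (∀ v → v ∈ p) →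
    Linked (λ a b → weight a b ≤ 1) p
  weight≤1 {p = p} path covers = Linked-infixes p λ pre a b ys p≡ →
    +-≤1 (χ≤1 inj-out a) (χ≤1 inj-in b) (not-both pre a b ys p≡)
    where
    +-≤1 : ∀ {x y} → x ≤ 1 → y ≤ 1 → (1 ≤ x → 1 ≤ y → ⊥) → x + y ≤ 1
    +-≤1 z≤n       y≤1       _ = y≤1
    +-≤1 (s≤s z≤n) z≤n       _ = s≤s z≤n
    +-≤1 (s≤s z≤n) (s≤s z≤n) ¬both = ⊥-elim (¬both (s≤s z≤n) (s≤s z≤n))

    not-both : ∀ pre a b ys → p ≡ pre ++ a ∷ b ∷ ys → 1 ≤ χₒ a → 1 ≤ χᵢ b → ⊥
    not-both pre a b ys p≡ 1≤χa 1≤χb with χ>0⇒label {f = o} 1≤χa | χ>0⇒label {f = i} 1≤χb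
    ... | m , refl | m′ , refl =
      no-out→in pre m m′ ys (subst (IsPath G _ _) p≡ path) (λ v → subst (v ∈_) p≡ (covers v))

  weights-sum : ∀ {j j′ x r} → IsPath G (i j) (o j′) (x ∷ r) → (∀ v → v ∈ x ∷ r) →
    pairSum weight (x ∷ r) ≡ length r
  weights-sum {j} {j′} {x} {r} (_ , p! , p-head , p-last) covers = suc-injective (suc-injective (begin
    1 + 1 + pairSum weight (x ∷ r)
      ≡⟨ cong₂ (λ a b → a + b + pairSum weight (x ∷ r)) (sym (χ-label inj-out j′)) (sym x-incoming) ⟩
    χₒ (o j′) + χᵢ x + pairSum weight (x ∷ r)
      ≡⟨ pairSum-telescope χₒ χᵢ r p-last ⟩
    ∑ (x ∷ r) χₒ + ∑ (x ∷ r) χᵢ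
      ≡⟨ cong₂ _+_ (∑-χ {f = o} p! covers) (∑-χ {f = i} p! covers) ⟩
    suc k + suc k
      ≡⟨ cong suc (sym size) ⟩
    suc n
      ≡⟨ cong suc (sym (Unique∧covering⇒length≡ p! covers)) ⟩
    suc (suc (length r)) ∎))
    where
    open ≡-Reasoning
    x-incoming : χᵢ x ≡ 1
    x-incoming = trans (cong χᵢ (just-injective p-head)) (χ-label inj-in j)

  Hamiltonian-steps : ∀ {j j′ p} → IsPath G (i j) (o j′) p → (∀ v → v ∈ p) →
    Linked (λ a b → Edge G a b × 1 ≤ weight a b) p
  Hamiltonian-steps {p = x ∷ r} path@(walk , _) covers = Linked.zip (walk ,
    pairSum-saturated r (weight≤1 path covers) (≤-reflexive (sym (weights-sum path covers))))

  outgoing-in-neighbour : ∀ v → χᵢ v ≡ 0 → ∀ j → ∃ λ a → Edge G a v × 1 ≤ χₒ a × a ≢ o j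
  outgoing-in-neighbour v χᵢv≡0 j with paired-yes j
  ... | p , path@(_ , p! , p-head , p-last) , covers
    with predecessor (Hamiltonian-steps path covers) p! (covers v) v≢head p-last
    where
    v≢head : head p ≢ just v
    v≢head head≡v = 0≢1+n (trans (sym χᵢv≡0)
      (trans (cong χᵢ (just-injective (trans (sym head≡v) p-head))) (χ-label inj-in j)))
  ... | a , (a→v , 1≤w) , a≢oj =
    a , a→v , ≤-trans 1≤w (≤-reflexive (trans (cong (χₒ a +_) χᵢv≡0) (+-identityʳ _))) , a≢oj

  incoming-out-neighbour : ∀ v → χₒ v ≡ 0 → ∀ j → ∃ λ b → Edge G v b × 1 ≤ χᵢ b × b ≢ i j
  incoming-out-neighbour v χₒv≡0 j with paired-yes j
  ... | [] , (_ , _ , () , _) , _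
  ... | x ∷ r , path@(_ , p! , p-head , p-last) , covers
    with successor (Hamiltonian-steps path covers) (covers v) v≢last
    where
    v≢last : last (x ∷ r) ≢ just v
    v≢last last≡v = 0≢1+n (trans (sym χₒv≡0)
      (trans (cong χₒ (just-injective (trans (sym last≡v) p-last))) (χ-label inj-out j)))
  ... | b , (v→b , 1≤w) , b∈r = b , v→b , ≤-trans 1≤w (≤-reflexive (cong (_+ χᵢ b) χₒv≡0)) ,
    λ { refl → Unique[x∷xs]⇒x∉xs p! (subst (_∈ r) (sym (just-injective p-head)) b∈r) }

  -- The second neighbour comes from the Hamiltonian path ending at the first one.
  two-outgoing-in-neighbours : ∀ v → χᵢ v ≡ 0 → AtLeastTwo (λ a → Edge G a v × 1 ≤ χₒ a)
  two-outgoing-in-neighbours v χᵢv≡0 with outgoing-in-neighbour v χᵢv≡0 Fin.zero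
  ... | a , a→v , 1≤χa , _ with χ>0⇒label {f = o} 1≤χa
  ... | m , refl with outgoing-in-neighbour v χᵢv≡0 m
  ... | a′ , a′→v , 1≤χa′ , a′≢om = o m , a′ , ≢-sym a′≢om , (a→v , 1≤χa) , (a′→v , 1≤χa′)

  two-incoming-out-neighbours : ∀ v → χₒ v ≡ 0 → AtLeastTwo (λ b → Edge G v b × 1 ≤ χᵢ b)
  two-incoming-out-neighbours v χₒv≡0 with incoming-out-neighbour v χₒv≡0 Fin.zero
  ... | b , v→b , 1≤χb , _ with χ>0⇒label {f = i} 1≤χb
  ... | m , refl with incoming-out-neighbour v χₒv≡0 m
  ... | b′ , v→b′ , 1≤χb′ , b′≢im = i m , b′ , ≢-sym b′≢im , (v→b , 1≤χb) , (v→b′ , 1≤χb′)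

  non-labels : ∀ {f : Fin (suc k) → Fin n} → Injective _≡_ _≡_ f → ∑[ v ← allFin n ] (1 ∸ χ f v) ≡ k
  non-labels f-inj = +-cancelʳ-≡ (suc k) _ k (trans (∑-χ-complement f-inj) size)

  edgeCount-≥4k : (k + k) + (k + k) ≤ edgeCount G
  edgeCount-≥4k = subst (_≤ edgeCount G)
    (cong₂ (λ x y → (x + x) + (y + y)) (non-labels inj-in) (non-labels inj-out))
    (EdgeLowerBound.edgeCount-≥ G χₒ χᵢ (χ≤1 inj-out) (χ≤1 inj-in)
      two-outgoing-in-neighbours two-incoming-out-neighbours)

theorem1 : (k : ℕ) → 1 ≤ k → (G : DiGraph (2 * k ∸ 1)) →
    (i o : Fin k → Fin (2 * k ∸ 1)) → IsInOut G i o →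
    4 * k ∸ 4 ≤ edgeCount G
theorem1 (suc k) _ G i o io = begin
  4 * suc k ∸ 4        ≡⟨ cong (_∸ 4) (*-suc 4 k) ⟩
  4 + 4 * k ∸ 4        ≡⟨ m+n∸m≡n 4 (4 * k) ⟩
  4 * k                ≡⟨ quadruple k ⟩
  (k + k) + (k + k)    ≤⟨ InOutGraph.edgeCount-≥4k G i o io (cong (k +_) (+-identityʳ (suc k))) ⟩
  edgeCount G          ∎
  where
  open ≤-Reasoning
  quadruple : ∀ k → 4 * k ≡ (k + k) + (k + k)
  quadruple = solve-∀
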